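{- Let $C_a$ and $C_b$ be comparator networks on $n$ channels. If for some $x\in\{0,1\}$ and $0\le k\le n$ we have $|w(C_a,x,k)|>|w(C_b,x,k)|$, then $C_a\not\preceq C_b$.
   Context: A comparator network on $n$ channels is a sequence of comparators $(i,j)$, $1\le i<j\le n$; on input $\vec x\in\{0,1\}^n$ each comparator swaps positions $i,j$ if $x_i>x_j$, applied in order, giving output $C(\vec x)$; $\mathsf{outputs}(C)=\{C(\vec x):\vec x\in\{0,1\}^n\}$. A permutation $\pi$ of $\{1,\dots,n\}$ acts on vectors by permuting positions and on sets elementwise. $C_a\preceq C_b$ means there exists a permutation $\pi$ with $\pi(\mathsf{outputs}(C_a))\subseteq\mathsf{outputs}(C_b)$. For a comparator network $C$ on $n$ channels, $x\in\{0,1\}$ and integer $0\le k\le n$, $w(C,x,k)$ is the set of positions $i\in\{1,\dots,n\}$ such that there exists a vector $x_1\ldots x_n\in\mathsf{outputs}(C)$ containing exactly $k$ ones with $x_i=x$. -}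

module Defs where

open import Data.Nat using (ℕ; zero; suc; _+_; _<_)
open import Data.Nat.Properties using (_≟_)
open import Data.Bool using (Bool; true; false; _∧_; if_then_else_)
open import Data.Bool.Properties renaming (_≟_ to _≟ᵇ_)
open import Data.Fin using (Fin; toℕ)
open import Data.Fin.Subset using (Subset)
open import Data.Fin.Permutation using (Permutation′; _⟨$⟩ʳ_; _⟨$⟩ˡ_)
open import Data.Vec using (Vec; []; _∷_; lookup; tabulate; count)
open import Data.List using (List; []; _∷_; map; _++_; foldl)
open import Data.Bool.ListAction using (any)
open import Data.Product using (Σ; ∃; _×_; _,_)
open import Relation.Binary.PropositionalEquality using (_≡_)
open import Relation.Nullary.Decidable using (⌊_⌋; does)

-- A comparator (i , j) on n channels, with i < j (as in the paper, 1 ≤ i < j ≤ n;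
-- channels are 0-indexed here).
record Comparator (n : ℕ) : Set where
  constructor comparator
  field
    i   : Fin n
    j   : Fin n
    i<j : toℕ i < toℕ j

Network : ℕ → Set
Network n = List (Comparator n)

-- Binary vectors: Bool, with false = 0, true = 1.
BVec : ℕ → Set
BVec n = Vec Bool n

-- Apply a comparator: if x_i > x_j (i.e. x_i = 1, x_j = 0) swap positions i, j.
-- Equivalently, position i gets min(x_i,x_j) = x_i ∧ x_j, position j gets max.
applyComparator : ∀ {n} → Comparator n → BVec n → BVec n
applyComparator {n} (comparator i j _) v = tabulate f
  where
  xi = lookup v i
  xj = lookup v j
  f : Fin n → Bool
  f k with does (k Data.Fin.≟ i) | does (k Data.Fin.≟ j)
  ... | true  | _     = if xi then xj else xi
  ... | false | true  = if xi then xi else xj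
  ... | false | false = lookup v k

run : ∀ {n} → Network n → BVec n → BVec n
run C v = foldl (λ w c → applyComparator c w) v C

InOutputs : ∀ {n} → Network n → BVec n → Set
InOutputs C y = ∃ λ x → run C x ≡ y

-- A permutation π acts on a vector by permuting positions:
-- (π v)_{π(i)} = v_i, i.e. (π v)_k = v_{π⁻¹(k)}.
permute : ∀ {n} → Permutation′ n → BVec n → BVec n
permute π v = tabulate (λ k → lookup v (π ⟨$⟩ˡ k))

_⪯_ : ∀ {n} → Network n → Network n → Set
_⪯_ {n} Ca Cb = Σ (Permutation′ n) λ π →
  ∀ y → InOutputs Ca y → InOutputs Cb (permute π y)

allBVecs : (n : ℕ) → List (BVec n)
allBVecs zero    = [] ∷ []
allBVecs (suc n) = map (false ∷_) (allBVecs n) ++ map (true ∷_) (allBVecs n)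

ones : ∀ {n} → BVec n → ℕ
ones v = count (λ b → b ≟ᵇ true) v

-- w(C, x, k): positions i such that some output of C with exactly k ones
-- has x at position i. Computed by enumerating all 2^n inputs.
w : ∀ {n} → Network n → Bool → ℕ → Subset n
w {n} C x k = tabulate λ i →
  any (λ v → let y = run C v in
             does (ones y ≟ k) ∧ does (lookup y i ≟ᵇ x))
      (allBVecs n)

module Submission where

-- If π(outputs Ca) ⊆ outputs Cb, then every output of Ca with k ones witnessing
-- i ∈ w(Ca,x,k) is carried by π to an output of Cb with k ones witnessing
-- π(i) ∈ w(Cb,x,k). So π maps w(Ca,x,k) injectively into w(Cb,x,k), and
-- |w(Ca,x,k)| ≤ |w(Cb,x,k)|.

open import Defs
open import Data.Nat using (ℕ; _≤_; _>_)
open import Data.Bool using (Bool)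
open import Data.Fin.Subset using (∣_∣)
open import Relation.Nullary using (¬_)

open import Level using (Level)
open import Function using (_∘_; _⇔_; Equivalence; mk⇔)
import Data.Nat as ℕ
open import Data.Nat using (suc)
open import Data.Nat.Properties using (+-0-commutativeMonoid; <⇒≱)
import Data.Bool as 𝔹
open import Data.Bool using (true; false; if_then_else_; T)
open import Data.Bool.Properties using (T-≡)
open import Data.Bool.ListAction using (any)
open import Data.Fin using (Fin)
open import Data.Fin.Subset using (Subset; _∈_; _⊆_)
open import Data.Fin.Subset.Properties using (p⊆q⇒∣p∣≤∣q∣)
open import Data.Fin.Permutation using (Permutation′; _⟨$⟩ʳ_; flip; inverseˡ)
open import Data.Vec using (Vec; []; _∷_; lookup; tabulate; count)
open import Data.Vec.Properties using (lookup∘tabulate; []=⇒lookup; lookup⇒[]=)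
open import Data.List.Relation.Unary.Any using (here; satisfied)
open import Data.List.Relation.Unary.Any.Properties using (any⁺; any⁻)
open import Data.List.Membership.Propositional using (lose) renaming (_∈_ to _∈ₗ_)
open import Data.List.Membership.Propositional.Properties using (∈-map⁺; ∈-++⁺ˡ; ∈-++⁺ʳ)
open import Data.Product using (∃; _×_; _,_)
open import Relation.Binary.PropositionalEquality using (_≡_; refl; sym; trans; cong; module ≡-Reasoning)
open import Relation.Nullary using (Dec; does; _because_; _×-dec_)
open import Relation.Nullary.Reflects using (invert)
open import Relation.Unary using (Pred; Decidable)
open import Algebra.Properties.CommutativeMonoid.Sum +-0-commutativeMonoid
  using (sum; sum-permute; sum-cong-≗)

private
  variable
    a p : Level
    A : Set a
    n : ℕ

T-does⇔ : (a? : Dec A) → T (does a?) ⇔ A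
T-does⇔ (true  because [a])  = mk⇔ (λ _ → invert [a]) _
T-does⇔ (false because [¬a]) = mk⇔ (λ ()) (invert [¬a])

module _ {P : Pred A p} (P? : Decidable P) where

  indicator : A → ℕ
  indicator x = if does (P? x) then 1 else 0

  count≡sum-indicator : (v : Vec A n) → count P? v ≡ sum (indicator ∘ lookup v)
  count≡sum-indicator []      = refl
  count≡sum-indicator (x ∷ v) with does (P? x)
  ... | true  = cong suc (count≡sum-indicator v)
  ... | false = count≡sum-indicator v

  count-permute : (π : Permutation′ n) (v : Vec A n) →
    count P? (tabulate (lookup v ∘ (π ⟨$⟩ʳ_))) ≡ count P? v
  count-permute π v = begin
    count P? (tabulate (lookup v ∘ (π ⟨$⟩ʳ_)))
      ≡⟨ count≡sum-indicator (tabulate (lookup v ∘ (π ⟨$⟩ʳ_))) ⟩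
    sum (λ i → indicator (lookup (tabulate (lookup v ∘ (π ⟨$⟩ʳ_))) i))
      ≡⟨ sum-cong-≗ (λ i → cong indicator (lookup∘tabulate (lookup v ∘ (π ⟨$⟩ʳ_)) i)) ⟩
    sum (λ i → indicator (lookup v (π ⟨$⟩ʳ i)))
      ≡⟨ sym (sum-permute (indicator ∘ lookup v) π) ⟩
    sum (indicator ∘ lookup v)
      ≡⟨ sym (count≡sum-indicator v) ⟩
    count P? v ∎
    where open ≡-Reasoning

ones-permute : (π : Permutation′ n) (y : BVec n) → ones (permute π y) ≡ ones y
ones-permute π = count-permute _ (flip π)

lookup-permute : (π : Permutation′ n) (y : BVec n) (i : Fin n) →
  lookup (permute π y) (π ⟨$⟩ʳ i) ≡ lookup y i
lookup-permute π y i = trans (lookup∘tabulate _ (π ⟨$⟩ʳ i)) (cong (lookup y) (inverseˡ π))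

∣p∣≤∣q∣-along-permutation : {p q : Subset n} (π : Permutation′ n) →
  (∀ {i} → i ∈ p → π ⟨$⟩ʳ i ∈ q) → ∣ p ∣ ≤ ∣ q ∣
∣p∣≤∣q∣-along-permutation {p = p} {q} π p⇒q
  rewrite sym (count-permute (𝔹._≟ true) π q) = p⊆q⇒∣p∣≤∣q∣ p⊆q∘π
  where
  p⊆q∘π : p ⊆ tabulate (lookup q ∘ (π ⟨$⟩ʳ_))
  p⊆q∘π {i} i∈p = lookup⇒[]= i _ (trans (lookup∘tabulate _ i) ([]=⇒lookup (p⇒q i∈p)))

∈-allBVecs : (v : BVec n) → v ∈ₗ allBVecs n
∈-allBVecs []          = here refl
∈-allBVecs (false ∷ v) = ∈-++⁺ˡ (∈-map⁺ (false ∷_) (∈-allBVecs v))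
∈-allBVecs (true ∷ v)  = ∈-++⁺ʳ _ (∈-map⁺ (true ∷_) (∈-allBVecs v))

Occurs : Network n → Bool → ℕ → Fin n → Set
Occurs C x k i = ∃ λ y → InOutputs C y × ones y ≡ k × lookup y i ≡ x

occursIn? : (C : Network n) (x : Bool) (k : ℕ) (i : Fin n) (v : BVec n) →
  Dec (ones (run C v) ≡ k × lookup (run C v) i ≡ x)
occursIn? C x k i v = (ones (run C v) ℕ.≟ k) ×-dec (lookup (run C v) i 𝔹.≟ x)

lookup-w : (C : Network n) (x : Bool) (k : ℕ) (i : Fin n) →
  lookup (w C x k) i ≡ any (does ∘ occursIn? C x k i) (allBVecs n)
lookup-w C x k i = lookup∘tabulate _ i

∈w⁻ : (C : Network n) {x : Bool} {k : ℕ} {i : Fin n} → i ∈ w C x k → Occurs C x k i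
∈w⁻ C {x} {k} {i} i∈w
  with v , occurs ← satisfied (any⁻ (does ∘ occursIn? C x k i) (allBVecs _)
         (Equivalence.from T-≡ (trans (sym (lookup-w C x k i)) ([]=⇒lookup i∈w))))
  = run C v , (v , refl) , Equivalence.to (T-does⇔ (occursIn? C x k i v)) occurs

∈w⁺ : (C : Network n) {x : Bool} {k : ℕ} {i : Fin n} → Occurs C x k i → i ∈ w C x k
∈w⁺ C {x} {k} {i} (_ , (v , refl) , occurs) = lookup⇒[]= i _ (trans (lookup-w C x k i)
  (Equivalence.to T-≡ (any⁺ (does ∘ occursIn? C x k i)
    (lose (∈-allBVecs v) (Equivalence.from (T-does⇔ (occursIn? C x k i v)) occurs)))))

⪯-transports-Occurs : (Ca Cb : Network n) ((π , _) : Ca ⪯ Cb) {x : Bool} {k : ℕ} {i : Fin n} →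
  Occurs Ca x k i → Occurs Cb x k (π ⟨$⟩ʳ i)
⪯-transports-Occurs _ _ (π , π[Ca]⊆Cb) {i = i} (y , y∈Ca , ones≡k , yᵢ≡x) =
  permute π y , π[Ca]⊆Cb y y∈Ca , trans (ones-permute π y) ones≡k , trans (lookup-permute π y i) yᵢ≡x

⪯⇒∣w∣≤∣w∣ : (Ca Cb : Network n) → Ca ⪯ Cb → (x : Bool) (k : ℕ) → ∣ w Ca x k ∣ ≤ ∣ w Cb x k ∣
⪯⇒∣w∣≤∣w∣ Ca Cb Ca⪯Cb@(π , _) x k =
  ∣p∣≤∣q∣-along-permutation π (∈w⁺ Cb ∘ ⪯-transports-Occurs Ca Cb Ca⪯Cb ∘ ∈w⁻ Ca)

lemma5 : (n : ℕ) (Ca Cb : Network n) (x : Bool) (k : ℕ) → k ≤ n →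
    ∣ w Ca x k ∣ > ∣ w Cb x k ∣ → ¬ (Ca ⪯ Cb)
lemma5 n Ca Cb x k _ ∣wCb∣<∣wCa∣ Ca⪯Cb = <⇒≱ ∣wCb∣<∣wCa∣ (⪯⇒∣w∣≤∣w∣ Ca Cb Ca⪯Cb x k)
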